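{- If a combinatorial proposition has a combinatorial proof, then it is true.
   Context: A graph $(V,E)$: finite $V$, $E$ a set of two-element subsets of $V$; write $vw$. A homomorphism $h:G\to G'$ satisfies $vw\in E(G)\Rightarrow h(v)h(w)\in E(G')$; it is a skew fibration if for every $v\in V(G)$ and every $w$ with $h(v)w\in E(G')$ there is $\hat w$ with $v\hat w\in E(G)$ and $h(\hat w)w\notin E(G')$. A cograph is a graph with nonempty vertex set such that for distinct $v,w,x,y$ the edges among $\{v,w,x,y\}$ are not exactly $\{vw,wx,xy\}$. Atoms: literals $p,\overline p$ (variables $p$) and constants $0,1$; $p,\overline p$ dual. A combinatorial proposition is a cograph with an atom label on each vertex. A stable set contains no edge; a clause is a maximal stable set; a clause is true if it contains a $1$-labelled vertex or two vertices labelled by dual literals; a labelled graph is true if all its clauses are true. A coloured graph has an equivalence relation $\sim$ on $V$ with $v\sim w$, $v\ne w$ implying $vw\notin E$; classes are colour classes. $W$ induces a matching if $W\ne\emptyset$ and each $w\in W$ has a unique $w'\in W$ with $ww'\in E$. Nicely coloured: every colour class has at most two vertices and no union of two-vertex colour classes induces a matching. A combinatorial proof of a combinatorial proposition $P$ is a skew fibration $h:C\to P$ from a nicely coloured cograph $C$ whose colour classes are axiomatic: a class $\{v\}$ with $h(v)$ labelled $1$, or a class $\{v,w\}$ with $h(v),h(w)$ labelled by dual literals. -}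

module Defs where

open import Data.Nat using (ℕ)
open import Data.Fin using (Fin)
open import Data.Bool using (Bool; true; false)
open import Data.Product using (Σ; ∃; ∃-syntax; _×_; _,_)
open import Data.Sum using (_⊎_)
open import Relation.Binary.PropositionalEquality using (_≡_)
open import Relation.Nullary using (¬_)

record Graph : Set where
  field
    size   : ℕ
    adj    : Fin size → Fin size → Bool
    sym    : ∀ v w → adj v w ≡ adj w v
    irrefl : ∀ v → adj v v ≡ false
open Graph public

Edge : (G : Graph) → Fin (size G) → Fin (size G) → Set
Edge G v w = adj G v w ≡ true

IsHom : (G G' : Graph) → (Fin (size G) → Fin (size G')) → Set
IsHom G G' h = ∀ v w → Edge G v w → Edge G' (h v) (h w)

IsSkewFibration : (G G' : Graph) → (Fin (size G) → Fin (size G')) → Set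
IsSkewFibration G G' h =
  IsHom G G' h ×
  (∀ v w → Edge G' (h v) w →
     ∃[ ŵ ] (Edge G v ŵ × ¬ Edge G' (h ŵ) w))

-- Cograph: nonempty vertex set, no induced P4
IsCograph : Graph → Set
IsCograph G =
  Fin (size G) ×
  (∀ v w x y →
     ¬ v ≡ w → ¬ v ≡ x → ¬ v ≡ y → ¬ w ≡ x → ¬ w ≡ y → ¬ x ≡ y →
     ¬ (Edge G v w × Edge G w x × Edge G x y ×
        ¬ Edge G v x × ¬ Edge G v y × ¬ Edge G w y))

data Atom : Set where
  pos  : ℕ → Atom
  neg  : ℕ → Atom
  zero : Atom
  one  : Atom

Dual : Atom → Atom → Set
Dual a b = ∃[ p ] ((a ≡ pos p × b ≡ neg p) ⊎ (a ≡ neg p × b ≡ pos p))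

record CombProp : Set where
  field
    graph     : Graph
    isCograph : IsCograph graph
    label     : Fin (size graph) → Atom
open CombProp public

Subset : Graph → Set
Subset G = Fin (size G) → Bool

_∈_ : {n : ℕ} → Fin n → (Fin n → Bool) → Set
v ∈ S = S v ≡ true

IsStable : (G : Graph) → Subset G → Set
IsStable G S = ∀ v w → v ∈ S → w ∈ S → ¬ Edge G v w

IsClause : (G : Graph) → Subset G → Set
IsClause G S =
  IsStable G S ×
  (∀ (T : Subset G) → IsStable G T → (∀ v → v ∈ S → v ∈ T) → (∀ v → v ∈ T → v ∈ S))

ClauseTrue : (G : Graph) → (Fin (size G) → Atom) → Subset G → Set
ClauseTrue G ℓ S =
  (∃[ v ] (v ∈ S × ℓ v ≡ one)) ⊎
  (∃[ v ] ∃[ w ] (v ∈ S × w ∈ S × Dual (ℓ v) (ℓ w)))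

IsTrue : CombProp → Set
IsTrue P = ∀ (S : Subset (graph P)) → IsClause (graph P) S → ClauseTrue (graph P) (label P) S

record Colouring (G : Graph) : Set where
  field
    _~_      : Fin (size G) → Fin (size G) → Bool
    ~-refl   : ∀ v → (v ~ v) ≡ true
    ~-sym    : ∀ v w → (v ~ w) ≡ true → (w ~ v) ≡ true
    ~-trans  : ∀ u v w → (u ~ v) ≡ true → (v ~ w) ≡ true → (u ~ w) ≡ true
    ~-indep  : ∀ v w → (v ~ w) ≡ true → ¬ v ≡ w → ¬ Edge G v w
open Colouring public

Same : {G : Graph} → Colouring G → Fin (size G) → Fin (size G) → Set
Same c v w = _~_ c v w ≡ true

InducesMatching : (G : Graph) → Subset G → Set
InducesMatching G W =
  (∃[ w ] (w ∈ W)) ×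
  (∀ w → w ∈ W →
     ∃[ w' ] ((w' ∈ W × Edge G w w') ×
              (∀ w'' → w'' ∈ W → Edge G w w'' → w'' ≡ w')))

TwoVertexClass : {G : Graph} → Colouring G → Fin (size G) → Set
TwoVertexClass c v =
  ∃[ w ] (¬ v ≡ w × Same c v w × (∀ u → Same c v u → u ≡ v ⊎ u ≡ w))

UnionOfTwoVertexClasses : {G : Graph} → Colouring G → Subset G → Set
UnionOfTwoVertexClasses c W =
  (∀ v w → v ∈ W → Same c v w → w ∈ W) ×
  (∀ v → v ∈ W → TwoVertexClass c v)

NicelyColoured : (G : Graph) → Colouring G → Set
NicelyColoured G c =
  (∀ u v w → Same c u v → Same c u w → Same c v w →
     u ≡ v ⊎ u ≡ w ⊎ v ≡ w) ×
  (∀ (W : Subset G) → UnionOfTwoVertexClasses c W → ¬ InducesMatching G W)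

Axiomatic : (C : Graph) → Colouring C → {n : ℕ} →
            (Fin (size C) → Fin n) → (Fin n → Atom) → Set
Axiomatic C c h ℓ =
  ∀ v →
    ((∀ u → Same c v u → u ≡ v) × ℓ (h v) ≡ one) ⊎
    (∃[ w ] (¬ v ≡ w × Same c v w × (∀ u → Same c v u → u ≡ v ⊎ u ≡ w) ×
             Dual (ℓ (h v)) (ℓ (h w))))

record CombinatorialProof (P : CombProp) : Set where
  field
    C          : Graph
    C-cograph  : IsCograph C
    colouring  : Colouring C
    nice       : NicelyColoured C colouring
    h          : Fin (size C) → Fin (size (graph P))
    skew       : IsSkewFibration C (graph P) h
    axiomatic  : Axiomatic C colouring h (label P)

module Submission where

-- Let S be a clause of P and K = h⁻¹(S). K is stable since h is a homomorphism. It is also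
-- dominating: a skew fibration between cographs sends a maximal clique Q through any vertex to
-- a clique h(Q) without common neighbour, and in a cograph such a clique meets every maximal
-- stable set. If some axiomatic colour class lies inside K, its labels make S true. Otherwise
-- every vertex of K has its colour partner outside K. Take J ⊆ K nonempty and ⊂-minimal such
-- that the partner of every j ∈ J has a neighbour in J. By minimality that neighbour is
-- unique, say t j, and t is a permutation of J; then J together with the partners of its
-- elements is a union of two-vertex colour classes inducing a matching, which niceness forbids.

open import Defs
open import Data.Bool using (Bool; true; false; _∨_)
import Data.Bool.Properties as Bool
open import Data.Empty using (⊥; ⊥-elim)
open import Data.Fin using (Fin; punchOut)
open import Data.Fin.Properties using (_≟_; any?; all?; punchOut-injective; <⇒notInjective)
open import Data.Fin.Subset
  using (_⊆_; _⊂_; _∩_; _∪_; _-_; ⁅_⁆; Nonempty)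
  renaming (Subset to FinSubset; _∈_ to _∈ₛ_; _∉_ to _∉ₛ_)
open import Data.Fin.Subset.Properties
  using (_∈?_; _⊆?_; anySubset?; x∈p∩q⁺; x∈p∩q⁻; x∈p∪q⁺; x∈p∪q⁻; p⊆p∪q;
         x∈⁅x⁆; x∈⁅y⁆⇒x≡y; x∈p∧x≢y⇒x∈p-y; x∈p⇒p-x⊂p)
open import Data.Fin.Subset.Induction using (⊂-wellFounded; ⊃-wellFounded)
open import Data.Nat using (ℕ)
open import Data.Nat.Properties using (n<1+n)
open import Data.Product using (∃; ∃-syntax; _×_; _,_; proj₁; proj₂)
open import Data.Sum using (_⊎_; inj₁; inj₂; swap)
open import Data.Vec using (tabulate)
open import Data.Vec.Properties using (lookup∘tabulate; lookup⇒[]=; []=⇒lookup; ≡-dec)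
open import Data.Vec.Functional using (updateAt)
open import Data.Vec.Functional.Properties using (updateAt-updates; updateAt-minimal)
open import Function using (id; _∘_; case_of_)
open import Induction.WellFounded using (WellFounded; Acc; acc)
open import Level using (0ℓ)
open import Relation.Binary using (Rel)
open import Relation.Binary.PropositionalEquality
  using (_≡_; _≢_; refl; trans; cong; subst) renaming (sym to ≡-sym)
open import Relation.Nullary using (¬_; Dec; yes; no; does; ¬?; contradiction)
open import Relation.Nullary.Decidable
  using (_×-dec_; _→-dec_; map′; decidable-stable; dec-true)
open import Relation.Unary using (Pred; Decidable)

module _ {A : Set} {_<_ : Rel A 0ℓ} (<-wellFounded : WellFounded _<_) {P : Pred A 0ℓ}
         (below? : ∀ x → Dec (∃[ y ] (P y × y < x))) where

  wf-minimal : ∃ P → ∃[ x ] (P x × ∀ {y} → P y → ¬ y < x)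
  wf-minimal (x , Px) = descend (<-wellFounded x) Px
    where
    descend : ∀ {x} → Acc _<_ x → P x → ∃[ x ] (P x × ∀ {y} → P y → ¬ y < x)
    descend {x} (acc rs) Px with below? x
    ... | yes (y , Py , y<x) = descend (rs y<x) Py
    ... | no nothing-below = x , Px , λ Py y<x → nothing-below (_ , Py , y<x)

_⊂?_ : ∀ {n} (p q : FinSubset n) → Dec (p ⊂ q)
p ⊂? q = (p ⊆? q) ×-dec any? (λ x → (x ∈? q) ×-dec ¬? (x ∈? p))

module _ {n} {P : Pred (FinSubset n) 0ℓ} (P? : Decidable P) where

  ⊂-minimal : ∃ P → ∃[ p ] (P p × ∀ {q} → P q → ¬ q ⊂ p)
  ⊂-minimal = wf-minimal ⊂-wellFounded (λ p → anySubset? (λ q → P? q ×-dec q ⊂? p))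

  ⊂-maximal : ∃ P → ∃[ p ] (P p × ∀ {q} → P q → ¬ p ⊂ q)
  ⊂-maximal = wf-minimal ⊃-wellFounded (λ p → anySubset? (λ q → P? q ×-dec p ⊂? q))

⊂-maximal-index : ∀ {m n} {A : Pred (Fin m) 0ℓ} → Decidable A → ∃ A →
                  (R : Fin m → FinSubset n) → ∃[ e ] (A e × ∀ {e′} → A e′ → ¬ R e ⊂ R e′)
⊂-maximal-index {A = A} A? (e , Ae) R with ⊂-maximal image? (R e , e , Ae , refl)
  where
  image? : Decidable (λ r → ∃[ e ] (A e × R e ≡ r))
  image? r = any? (λ e → A? e ×-dec ≡-dec Bool._≟_ (R e) r)
... | _ , (e , Ae , refl) , maximal = e , Ae , λ Ae′ → maximal (_ , Ae′ , refl)

∈-tabulate⁺ : ∀ {n} {f : Fin n → Bool} {x} → f x ≡ true → x ∈ₛ tabulate f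
∈-tabulate⁺ {f = f} {x} fx = lookup⇒[]= x (tabulate f) (trans (lookup∘tabulate f x) fx)

∈-tabulate⁻ : ∀ {n} {f : Fin n → Bool} {x} → x ∈ₛ tabulate f → f x ≡ true
∈-tabulate⁻ {f = f} {x} x∈ = trans (≡-sym (lookup∘tabulate f x)) ([]=⇒lookup x∈)

injective⇒¬missing : ∀ {n} {g : Fin n → Fin n} →
                     (∀ {y z} → g y ≡ g z → y ≡ z) → ∀ x → ¬ (∀ y → g y ≢ x)
injective⇒¬missing {ℕ.suc m} {g} g-injective x misses =
  <⇒notInjective {f = λ y → punchOut (misses y ∘ ≡-sym)} (n<1+n m)
    (λ eq → g-injective (punchOut-injective (misses _ ∘ ≡-sym) (misses _ ∘ ≡-sym) eq))

module _ {n} (t : Fin n → Fin n) (t-surjective : ∀ y → ∃[ x ] (t x ≡ y)) where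

  private
    section : Fin n → Fin n
    section = proj₁ ∘ t-surjective

    section-injective : ∀ {y z} → section y ≡ section z → y ≡ z
    section-injective {y} {z} eq =
      trans (≡-sym (proj₂ (t-surjective y))) (trans (cong t eq) (proj₂ (t-surjective z)))

    missed : ∀ {x} → section (t x) ≢ x → ∀ y → section y ≢ x
    missed not-fixed y refl = not-fixed (cong section (proj₂ (t-surjective y)))

  surjective⇒injective : ∀ {a b} → t a ≡ t b → a ≡ b
  surjective⇒injective {a} {b} ta≡tb with section (t a) ≟ a | section (t b) ≟ b
  ... | yes sa | yes sb = trans (≡-sym sa) (trans (cong section ta≡tb) sb)
  ... | no not-fixed | _ = ⊥-elim (injective⇒¬missing section-injective a (missed not-fixed))
  ... | _ | no not-fixed = ⊥-elim (injective⇒¬missing section-injective b (missed not-fixed))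

module _ (G : Graph) where

  Edge? : ∀ a b → Dec (Edge G a b)
  Edge? a b = adj G a b Bool.≟ true

  edge-sym : ∀ {a b} → Edge G a b → Edge G b a
  edge-sym {a} {b} e = trans (Graph.sym G b a) e

  edge-irrefl : ∀ {a} → ¬ Edge G a a
  edge-irrefl {a} e = contradiction (trans (≡-sym (irrefl G a)) e) λ ()

  edge-stable : ∀ {a b} → ¬ ¬ Edge G a b → Edge G a b
  edge-stable = decidable-stable (Edge? _ _)

  edge⇒≢ : ∀ {a b} → Edge G a b → a ≢ b
  edge⇒≢ e refl = edge-irrefl e

  no-induced-P4 : IsCograph G → ∀ {a b c d} → Edge G a b → Edge G b c → Edge G c d →
                  ¬ Edge G a c → ¬ Edge G a d → ¬ Edge G b d → ⊥
  no-induced-P4 (_ , P4-free) {a} {b} {c} {d} ab bc cd ¬ac ¬ad ¬bd =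
    P4-free a b c d (edge⇒≢ ab) (λ { refl → ¬ad cd }) (λ { refl → ¬bd (edge-sym ab) })
            (edge⇒≢ bc) (λ { refl → ¬ad ab }) (edge⇒≢ cd)
            (ab , bc , cd , ¬ac , ¬ad , ¬bd)

  insert : Subset G → Fin (size G) → Subset G
  insert S v u = S u ∨ does (u ≟ v)

  ∈-insert-old : ∀ S v {u} → u ∈ S → u ∈ insert S v
  ∈-insert-old S v u∈S rewrite u∈S = refl

  ∈-insert-new : ∀ S v → v ∈ insert S v
  ∈-insert-new S v with v ≟ v
  ... | yes _ = Bool.∨-zeroʳ (S v)
  ... | no v≢v = contradiction refl v≢v

  ∈-insert⁻ : ∀ S v u → u ∈ insert S v → u ∈ S ⊎ u ≡ v
  ∈-insert⁻ S v u with S u | u ≟ v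
  ... | true  | _       = λ _ → inj₁ refl
  ... | false | yes u≡v = λ _ → inj₂ u≡v
  ... | false | no _    = λ ()

  Dominating : Subset G → Set
  Dominating S = ∀ v → ¬ v ∈ S → ∃[ s ] (s ∈ S × Edge G v s)

  dominating-nonempty : ∀ {S} → Fin (size G) → Dominating S → ∃[ s ] (s ∈ S)
  dominating-nonempty {S} v S-dominating with S v Bool.≟ true
  ... | yes v∈S = v , v∈S
  ... | no v∉S = let s , s∈S , _ = S-dominating v v∉S in s , s∈S

  clause⇒dominating : ∀ {S} → IsClause G S → Dominating S
  clause⇒dominating {S} (S-stable , S-maximal) v v∉S
    with any? (λ s → (S s Bool.≟ true) ×-dec Edge? v s)
  ... | yes found = found
  ... | no isolated = ⊥-elim (v∉S (S-maximal (insert S v) stable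
                                     (λ _ → ∈-insert-old S v) v (∈-insert-new S v)))
    where
    stable : IsStable G (insert S v)
    stable a b a∈ b∈ with ∈-insert⁻ S v a a∈ | ∈-insert⁻ S v b b∈
    ... | inj₁ a∈S  | inj₁ b∈S  = S-stable a b a∈S b∈S
    ... | inj₁ a∈S  | inj₂ refl = λ e → isolated (a , a∈S , edge-sym e)
    ... | inj₂ refl | inj₁ b∈S  = λ e → isolated (b , b∈S , e)
    ... | inj₂ refl | inj₂ refl = edge-irrefl

module _ (G : Graph) {m} (f : Fin m → Fin (size G)) where

  IsClique : FinSubset m → Set
  IsClique Q = ∀ {a b} → a ∈ₛ Q → b ∈ₛ Q → f a ≢ f b → Edge G (f a) (f b)

  CommonNeighbour : FinSubset m → Fin (size G) → Set
  CommonNeighbour Q x = ∀ {q} → q ∈ₛ Q → Edge G x (f q)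

  common-or-missed : ∀ Q x → CommonNeighbour Q x ⊎ ∃[ q ] (q ∈ₛ Q × ¬ Edge G x (f q))
  common-or-missed Q x with any? (λ q → (q ∈? Q) ×-dec ¬? (Edge? G x (f q)))
  ... | yes missed = inj₂ missed
  ... | no none = inj₁ λ {q} q∈ → edge-stable G (λ ¬e → none (q , q∈ , ¬e))

  commonNeighbour? : ∀ Q x → Dec (CommonNeighbour Q x)
  commonNeighbour? Q x with common-or-missed Q x
  ... | inj₁ common = yes common
  ... | inj₂ (q , q∈ , ¬e) = no λ common → ¬e (common q∈)

  missed-by : ∀ {Q x} → ¬ CommonNeighbour Q x → ∃[ q ] (q ∈ₛ Q × ¬ Edge G x (f q))
  missed-by {Q} {x} ¬common with common-or-missed Q x
  ... | inj₁ common = ⊥-elim (¬common common)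
  ... | inj₂ missed = missed

  neighboursIn : FinSubset m → Fin (size G) → FinSubset m
  neighboursIn Q x = Q ∩ tabulate (λ q → adj G x (f q))

  ∈-neighboursIn⁺ : ∀ {Q x q} → q ∈ₛ Q → Edge G x (f q) → q ∈ₛ neighboursIn Q x
  ∈-neighboursIn⁺ q∈ e = x∈p∩q⁺ (q∈ , ∈-tabulate⁺ e)

  ∈-neighboursIn⁻ : ∀ {Q x q} → q ∈ₛ neighboursIn Q x → q ∈ₛ Q × Edge G x (f q)
  ∈-neighboursIn⁻ {Q} q∈ with x∈p∩q⁻ Q _ q∈
  ... | q∈Q , q∈N = q∈Q , ∈-tabulate⁻ q∈N

IsMaximalClique : (G : Graph) → FinSubset (size G) → Set
IsMaximalClique G Q = IsClique G id Q × (∀ x → ¬ CommonNeighbour G id Q x)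

maximal-clique-through : (G : Graph) (v : Fin (size G)) →
                         ∃[ Q ] (v ∈ₛ Q × IsMaximalClique G Q)
maximal-clique-through G v
  with ⊂-maximal clique-through-v? (⁅ v ⁆ , x∈⁅x⁆ v , singleton-clique)
  where
  clique? : ∀ Q → Dec (IsClique G id Q)
  clique? Q = map′ (λ cl {a} {b} → cl a b) (λ cl a b → cl)
    (all? λ a → all? λ b → (a ∈? Q) →-dec ((b ∈? Q) →-dec (¬? (a ≟ b) →-dec Edge? G a b)))
  clique-through-v? : Decidable (λ Q → v ∈ₛ Q × IsClique G id Q)
  clique-through-v? Q = (v ∈? Q) ×-dec clique? Q
  singleton-clique : IsClique G id ⁅ v ⁆
  singleton-clique a∈ b∈ a≢b =
    contradiction (trans (x∈⁅y⁆⇒x≡y v a∈) (≡-sym (x∈⁅y⁆⇒x≡y v b∈))) a≢b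
... | Q , (v∈Q , Q-clique) , maximal = Q , v∈Q , Q-clique , no-common-neighbour
  where
  no-common-neighbour : ∀ x → ¬ CommonNeighbour G id Q x
  no-common-neighbour x common =
    maximal (p⊆p∪q _ v∈Q , extended-clique)
            (p⊆p∪q _ , x , x∈p∪q⁺ (inj₂ (x∈⁅x⁆ x)) , edge-irrefl G ∘ common)
    where
    extended-clique : IsClique G id (Q ∪ ⁅ x ⁆)
    extended-clique {a} {b} a∈ b∈ a≢b with x∈p∪q⁻ Q _ a∈ | x∈p∪q⁻ Q _ b∈
    ... | inj₁ a∈Q | inj₁ b∈Q = Q-clique a∈Q b∈Q a≢b
    ... | inj₁ a∈Q | inj₂ b∈x rewrite x∈⁅y⁆⇒x≡y x b∈x = edge-sym G (common a∈Q)
    ... | inj₂ a∈x | inj₁ b∈Q rewrite x∈⁅y⁆⇒x≡y x a∈x = common b∈Q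
    ... | inj₂ a∈x | inj₂ b∈x =
      contradiction (trans (x∈⁅y⁆⇒x≡y x a∈x) (≡-sym (x∈⁅y⁆⇒x≡y x b∈x))) a≢b

hom-clique : ∀ {C P h Q} → IsHom C P h → IsClique C id Q → IsClique P h Q
hom-clique hom Q-clique a∈ b∈ ha≢hb = hom _ _ (Q-clique a∈ b∈ (ha≢hb ∘ cong _))

-- If f(Q) avoided S, take s ∈ S seeing a ⊂-maximal part of f(Q). A vertex f q it misses is
-- dominated by some s′ ∈ S, and s′ sees all that s sees, since an exception would close an
-- induced P4.
clique-meets-dominating-stable-set :
  ∀ {G m} {f : Fin m → Fin (size G)} {Q S} → IsCograph G →
  IsClique G f Q → (∀ x → ¬ CommonNeighbour G f Q x) →
  IsStable G S → Dominating G S → ∃[ q ] (q ∈ₛ Q × f q ∈ S)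
clique-meets-dominating-stable-set {G} {f = f} {Q} {S}
  G-cograph Q-clique no-common S-stable S-dominating
  with any? (λ q → (q ∈? Q) ×-dec (S (f q) Bool.≟ true))
... | yes meets = meets
... | no disjoint
  with ⊂-maximal-index (λ s → S s Bool.≟ true)
         (dominating-nonempty G (proj₁ G-cograph) S-dominating) (neighboursIn G f Q)
...   | s , s∈S , maximal with missed-by G f (no-common s)
...     | q , q∈Q , ¬sq with S-dominating (f q) (λ fq∈S → disjoint (q , q∈Q , fq∈S))
...       | s′ , s′∈S , q-s′ = ⊥-elim (maximal s′∈S
  (grows , q , ∈-neighboursIn⁺ G f q∈Q (edge-sym G q-s′) , ¬sq ∘ proj₂ ∘ ∈-neighboursIn⁻ G f))
  where
  grows : neighboursIn G f Q s ⊆ neighboursIn G f Q s′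
  grows q′∈ with ∈-neighboursIn⁻ G f q′∈
  ... | q′∈Q , s-q′ = ∈-neighboursIn⁺ G f q′∈Q (edge-stable G λ ¬s′q′ →
    no-induced-P4 G G-cograph
      s-q′ (Q-clique q′∈Q q∈Q λ same → ¬sq (subst (Edge G s) same s-q′)) q-s′
      ¬sq (S-stable _ _ s∈S s′∈S) (¬s′q′ ∘ edge-sym G))

module _ {C P : Graph} (C-cograph : IsCograph C) (P-cograph : IsCograph P)
         {h : Fin (size C) → Fin (size P)} (skew : IsSkewFibration C P h)
         {Q : FinSubset (size C)} (Q-clique : IsClique C id Q) where

  private
    hom = proj₁ skew
    lift = proj₂ skew

    hQ-clique : IsClique P h Q
    hQ-clique = hom-clique {C} {P} hom Q-clique

  SkewClosed : Fin (size P) → Pred (Fin (size C)) 0ℓ → Set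
  SkewClosed z A = ∀ {e q e′} → A e → q ∈ₛ Q → ¬ Edge P (h e) (h q) →
                   Edge C q e′ → ¬ Edge P (h e′) z → A e′

  -- Take e ∈ A whose image sees a ⊂-maximal part of h(Q). If h e missed some h q, lifting the
  -- edge h q – z at q would give e′ ∈ A whose image sees strictly more, since a vertex of h(Q)
  -- seen by h e but not by h e′ closes an induced P4.
  skew-closed-reaches-common-neighbour :
    ∀ {z} → CommonNeighbour P h Q z → {A : Pred (Fin (size C)) 0ℓ} → Decidable A →
    (∀ {e} → A e → ¬ Edge P (h e) z) → SkewClosed z A → ∃ A →
    ∃[ e ] (A e × CommonNeighbour P h Q (h e))
  skew-closed-reaches-common-neighbour {z} z-common A? A-avoids-z closed nonempty
    with ⊂-maximal-index A? nonempty (λ e → neighboursIn P h Q (h e))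
  ... | e , Ae , maximal with common-or-missed P h Q (h e)
  ...   | inj₁ e-common = e , Ae , e-common
  ...   | inj₂ (q , q∈Q , ¬eq) with lift q z (edge-sym P (z-common q∈Q))
  ...     | e′ , q-e′ , ¬e′z = ⊥-elim (maximal (closed Ae q∈Q ¬eq q-e′ ¬e′z)
    (grows , q , ∈-neighboursIn⁺ P h q∈Q (hom _ _ (edge-sym C q-e′)) ,
     ¬eq ∘ proj₂ ∘ ∈-neighboursIn⁻ P h))
    where
    grows : neighboursIn P h Q (h e) ⊆ neighboursIn P h Q (h e′)
    grows {q₅} q₅∈ with ∈-neighboursIn⁻ P h q₅∈
    ... | q₅∈Q , e-q₅ =
      ∈-neighboursIn⁺ P h q₅∈Q (edge-stable P (no-P4 (Edge? P (h e) (h e′))))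
      where
      no-P4 : Dec (Edge P (h e) (h e′)) → ¬ ¬ Edge P (h e′) (h q₅)
      no-P4 (yes e-e′) ¬e′q₅ =
        no-induced-P4 P P-cograph (z-common q₅∈Q) (edge-sym P e-q₅) e-e′
          (A-avoids-z Ae ∘ edge-sym P) (¬e′z ∘ edge-sym P) (¬e′q₅ ∘ edge-sym P)
      no-P4 (no ¬e-e′) ¬e′q₅ =
        no-induced-P4 P P-cograph
          e-q₅ (hQ-clique q₅∈Q q∈Q λ same → ¬eq (subst (Edge P (h e)) same e-q₅)) (hom _ _ q-e′)
          ¬eq ¬e-e′ (¬e′q₅ ∘ edge-sym P)

  private
    N : Fin (size C) → FinSubset (size C)
    N = neighboursIn C id Q

    absorbs : ∀ {c q′ e′} → ¬ Edge C c q′ → q′ ∈ₛ Q → Edge C q′ e′ →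
              ¬ Edge P (h e′) (h c) → N c ⊆ N e′
    absorbs {c} ¬cq′ q′∈Q q′-e′ ¬e′c q₃∈ with ∈-neighboursIn⁻ C id q₃∈
    ... | q₃∈Q , c-q₃ = ∈-neighboursIn⁺ C id q₃∈Q (edge-stable C λ ¬e′q₃ →
      no-induced-P4 C C-cograph
        c-q₃ (Q-clique q₃∈Q q′∈Q λ { refl → ¬cq′ c-q₃ }) q′-e′
        ¬cq′ (¬e′c ∘ edge-sym P ∘ hom _ _) (¬e′q₃ ∘ edge-sym C))

    Beyond : Fin (size C) → Fin (size C) → Pred (Fin (size C)) 0ℓ
    Beyond c q₂ e = ¬ Edge P (h e) (h c) × Edge C e q₂ × N c ⊆ N e

    beyond? : ∀ c q₂ → Decidable (Beyond c q₂)
    beyond? c q₂ e = ¬? (Edge? P (h e) (h c)) ×-dec Edge? C e q₂ ×-dec (N c ⊆? N e)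

    beyond-closed : ∀ {c q₂} → CommonNeighbour P h Q (h c) → q₂ ∈ₛ Q →
                    SkewClosed (h c) (Beyond c q₂)
    beyond-closed {c} {q₂} c-common q₂∈Q {e} {q₄} {e′}
                  (¬ec , e-q₂ , Nc⊆Ne) q₄∈Q ¬eq₄ q₄-e′ ¬e′c =
      ¬e′c , edge-stable C (e′-q₂ (Edge? C e e′)) , absorbs ¬cq₄ q₄∈Q q₄-e′ ¬e′c
      where
      ¬cq₄ : ¬ Edge C c q₄
      ¬cq₄ c-q₄ =
        ¬eq₄ (hom _ _ (proj₂ (∈-neighboursIn⁻ C id (Nc⊆Ne (∈-neighboursIn⁺ C id q₄∈Q c-q₄)))))
      e′-q₂ : Dec (Edge C e e′) → ¬ ¬ Edge C e′ q₂
      e′-q₂ (yes e-e′) _ =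
        no-induced-P4 P P-cograph
          (c-common q₄∈Q) (hom _ _ q₄-e′) (edge-sym P (hom _ _ e-e′))
          (¬e′c ∘ edge-sym P) (¬ec ∘ edge-sym P) (¬eq₄ ∘ edge-sym P)
      e′-q₂ (no ¬e-e′) ¬e′q₂ =
        no-induced-P4 C C-cograph
          e-q₂ (Q-clique q₂∈Q q₄∈Q λ { refl → ¬e′q₂ (edge-sym C q₄-e′) }) q₄-e′
          (¬eq₄ ∘ hom _ _) ¬e-e′ (¬e′q₂ ∘ edge-sym C)

  common-neighbour-in-image : ∃ (_∈ₛ Q) → ∀ {z} → CommonNeighbour P h Q z →
                              ∃[ c ] CommonNeighbour P h Q (h c)
  common-neighbour-in-image (q₀ , q₀∈Q) {z} z-common
    with lift q₀ z (edge-sym P (z-common q₀∈Q))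
  ... | e₀ , _ , ¬e₀z
    with skew-closed-reaches-common-neighbour z-common (λ e → ¬? (Edge? P (h e) z))
           id (λ _ _ _ _ ¬e′z → ¬e′z) (e₀ , ¬e₀z)
  ...   | e , _ , e-common = e , e-common

  -- Take c with h c a common neighbour of h(Q) and N c ⊂-maximal. By maximality of Q, c misses
  -- some q₂ ∈ Q, and lifting h q₂ – h c at q₂ starts a skew-closed family of vertices seeing q₂
  -- and all of N c; it reaches a common neighbour, whose N strictly contains N c.
  no-common-neighbour-in-image : (∀ x → ¬ CommonNeighbour C id Q x) →
                                 ∀ c₀ → ¬ CommonNeighbour P h Q (h c₀)
  no-common-neighbour-in-image Q-maximal c₀ c₀-common
    with ⊂-maximal-index (λ c → commonNeighbour? P h Q (h c)) (c₀ , c₀-common) N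
  ... | c , c-common , maximal with missed-by C id (Q-maximal c)
  ...   | q₂ , q₂∈Q , ¬cq₂ with lift q₂ (h c) (edge-sym P (c-common q₂∈Q))
  ...     | d , q₂-d , ¬dc
    with skew-closed-reaches-common-neighbour c-common (beyond? c q₂) proj₁
           (beyond-closed c-common q₂∈Q) (d , ¬dc , edge-sym C q₂-d , absorbs ¬cq₂ q₂∈Q q₂-d ¬dc)
  ...       | e , (_ , e-q₂ , Nc⊆Ne) , e-common =
    maximal e-common
      (Nc⊆Ne , q₂ , ∈-neighboursIn⁺ C id q₂∈Q e-q₂ , ¬cq₂ ∘ proj₂ ∘ ∈-neighboursIn⁻ C id)

  maximal-clique-image-has-no-common-neighbour :
    (∀ x → ¬ CommonNeighbour C id Q x) → ∀ z → ¬ CommonNeighbour P h Q z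
  maximal-clique-image-has-no-common-neighbour Q-maximal z z-common
    with missed-by C id (Q-maximal (proj₁ C-cograph))
  ... | q₀ , q₀∈Q , _ with common-neighbour-in-image (q₀ , q₀∈Q) z-common
  ...   | c , c-common = no-common-neighbour-in-image Q-maximal c c-common

preimage-stable : ∀ {C P h S} → IsHom C P h → IsStable P S → IsStable C (S ∘ h)
preimage-stable hom S-stable a b a∈ b∈ = S-stable _ _ a∈ b∈ ∘ hom a b

preimage-dominating : ∀ {C P h S} → IsCograph C → IsCograph P → IsSkewFibration C P h →
                      IsStable P S → Dominating P S → Dominating C (S ∘ h)
preimage-dominating {C} {P} {h} {S} C-cograph P-cograph skew S-stable S-dominating v v∉ =
  through (maximal-clique-through C v)
  where
  through : ∃[ Q ] (v ∈ₛ Q × IsMaximalClique C Q) → ∃[ s ] (s ∈ (S ∘ h) × Edge C v s)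
  through (Q , v∈Q , Q-clique , Q-maximal) =
    neighbour (clique-meets-dominating-stable-set {P} {f = h} {Q} P-cograph
                 (hom-clique {C} {P} (proj₁ skew) Q-clique)
                 (maximal-clique-image-has-no-common-neighbour {C} {P}
                    C-cograph P-cograph skew Q-clique Q-maximal)
                 S-stable S-dominating)
    where
    neighbour : ∃[ q ] (q ∈ₛ Q × h q ∈ S) → ∃[ s ] (s ∈ (S ∘ h) × Edge C v s)
    neighbour (q , q∈Q , hq∈S) = q , hq∈S , Q-clique v∈Q q∈Q λ { refl → v∉ hq∈S }

PairClass : {G : Graph} → Colouring G → Fin (size G) → Fin (size G) → Set
PairClass c v w = v ≢ w × Same c v w × (∀ u → Same c v u → u ≡ v ⊎ u ≡ w)

PairClass-sym : ∀ {G} {c : Colouring G} {v w} → PairClass c v w → PairClass c w v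
PairClass-sym {c = c} (v≢w , v~w , class) =
  v≢w ∘ ≡-sym , ~-sym c _ _ v~w , λ u w~u → swap (class u (~-trans c _ _ _ v~w w~u))

module _ {C : Graph} (C-cograph : IsCograph C) {col : Colouring C} (nice : NicelyColoured C col)
         {K : Subset C} (K-stable : IsStable C K) (K-dominating : Dominating C K)
         (p : Fin (size C) → Fin (size C))
         (p-outside : ∀ j → j ∈ K → PairClass col j (p j) × ¬ p j ∈ K) where

  private
    Closed : Pred (FinSubset (size C)) 0ℓ
    Closed J = ∀ j → j ∈ₛ J → ∃[ i ] (i ∈ₛ J × Edge C (p j) i)

    Candidate : Pred (FinSubset (size C)) 0ℓ
    Candidate J = Nonempty J × (∀ j → j ∈ₛ J → j ∈ K) × Closed J

    candidate? : Decidable Candidate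
    candidate? J = any? (_∈? J)
      ×-dec all? (λ j → (j ∈? J) →-dec (K j Bool.≟ true))
      ×-dec all? (λ j → (j ∈? J) →-dec any? (λ i → (i ∈? J) ×-dec Edge? C (p j) i))

    K-candidate : Candidate (tabulate K)
    K-candidate = K-nonempty , (λ _ → ∈-tabulate⁻) , K-closed
      where
      K-nonempty : Nonempty (tabulate K)
      K-nonempty = let j , j∈K = dominating-nonempty C (proj₁ C-cograph) K-dominating in
                   j , ∈-tabulate⁺ j∈K
      K-closed : Closed (tabulate K)
      K-closed j j∈ with K-dominating (p j) (proj₂ (p-outside j (∈-tabulate⁻ j∈)))
      ... | i , i∈K , pj-i = i , ∈-tabulate⁺ i∈K , pj-i

    module Minimal {J : FinSubset (size C)} (J-nonempty : Nonempty J)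
                   (J⊆K : ∀ j → j ∈ₛ J → j ∈ K) (J-closed : Closed J)
                   (J-minimal : ∀ {J′} → Candidate J′ → ¬ J′ ⊂ J) where

      pair : ∀ {j} → j ∈ₛ J → PairClass col j (p j)
      pair {j} j∈J = proj₁ (p-outside j (J⊆K j j∈J))

      ChoiceAt : Fin (size C) → Fin (size C) → Set
      ChoiceAt u v = (u ∈ₛ J → v ∈ₛ J × Edge C (p u) v) × (u ∉ₛ J → v ≡ u)

      IsChoice : (Fin (size C) → Fin (size C)) → Set
      IsChoice t = ∀ u → ChoiceAt u (t u)

      choice : ∃ IsChoice
      choice = proj₁ ∘ pick , proj₂ ∘ pick
        where
        pick : ∀ u → ∃ (ChoiceAt u)
        pick u with u ∈? J
        ... | yes u∈J = let i , i∈J , pu-i = J-closed u u∈J in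
                        i , (λ _ → i∈J , pu-i) , (λ u∉J → contradiction u∈J u∉J)
        ... | no u∉J = u , (λ u∈J → contradiction u∈J u∉J) , λ _ → refl

      -- A point y missed by a choice function lies in J, and J - y would be a smaller candidate.
      choice-surjective : ∀ {t} → IsChoice t → ∀ y → ∃[ x ] (t x ≡ y)
      choice-surjective {t} t-choice y with any? (λ x → t x ≟ y)
      ... | yes hit = hit
      ... | no missed with y ∈? J
      ...   | no y∉J = ⊥-elim (missed (y , proj₂ (t-choice y) y∉J))
      ...   | yes y∈J = ⊥-elim (J-minimal ((t y , into y∈J) , J-y⊆K , J-y-closed) J-y⊂J)
        where
        J-y⊂J : J - y ⊂ J
        J-y⊂J = x∈p⇒p-x⊂p y∈J
        into : ∀ {j} → j ∈ₛ J → t j ∈ₛ J - y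
        into {j} j∈J = x∈p∧x≢y⇒x∈p-y (proj₁ (proj₁ (t-choice j) j∈J)) (λ tj≡y → missed (j , tj≡y))
        J-y⊆K : ∀ j → j ∈ₛ J - y → j ∈ K
        J-y⊆K j j∈ = J⊆K j (proj₁ J-y⊂J j∈)
        J-y-closed : Closed (J - y)
        J-y-closed j j∈ =
          t j , into (proj₁ J-y⊂J j∈) , proj₂ (proj₁ (t-choice j) (proj₁ J-y⊂J j∈))

      choice-injective : ∀ {t} → IsChoice t → ∀ {a b} → t a ≡ t b → a ≡ b
      choice-injective {t} t-choice = surjective⇒injective t (choice-surjective t-choice)

      module Matching {t : Fin (size C) → Fin (size C)} (t-choice : IsChoice t) where

        t-in : ∀ {j} → j ∈ₛ J → t j ∈ₛ J
        t-in {j} j∈J = proj₁ (proj₁ (t-choice j) j∈J)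

        t-edge : ∀ {j} → j ∈ₛ J → Edge C (p j) (t j)
        t-edge {j} j∈J = proj₂ (proj₁ (t-choice j) j∈J)

        t-injective : ∀ {a b} → t a ≡ t b → a ≡ b
        t-injective = choice-injective t-choice

        t-preimage : ∀ {j} → j ∈ₛ J → ∃[ a ] (a ∈ₛ J × t a ≡ j)
        t-preimage {j} j∈J with choice-surjective t-choice j
        ... | a , ta≡j with a ∈? J
        ...   | yes a∈J = a , a∈J , ta≡j
        ...   | no a∉J =
          contradiction (subst (_∈ₛ J) (trans (≡-sym ta≡j) (proj₂ (t-choice a) a∉J)) j∈J) a∉J

        -- Redirecting t at j to another neighbour b would give a non-injective choice function.
        only-neighbour : ∀ {j b} → j ∈ₛ J → b ∈ₛ J → Edge C (p j) b → b ≡ t j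
        only-neighbour {j} {b} j∈J b∈J pj-b with t-preimage b∈J
        ... | a , _ , ta≡b with a ≟ j
        ...   | yes refl = ≡-sym ta≡b
        ...   | no a≢j =
          contradiction (choice-injective t′-choice (trans t′a≡b (≡-sym t′j≡b))) a≢j
          where
          t′ : Fin (size C) → Fin (size C)
          t′ = updateAt t j (λ _ → b)
          t′a≡b : t′ a ≡ b
          t′a≡b = trans (updateAt-minimal a j t a≢j) ta≡b
          t′j≡b : t′ j ≡ b
          t′j≡b = updateAt-updates j t
          t′-choice : IsChoice t′
          t′-choice u with u ≟ j
          ... | yes refl = subst (ChoiceAt j) (≡-sym t′j≡b)
                             ((λ _ → b∈J , pj-b) , λ j∉J → contradiction j∈J j∉J)
          ... | no u≢j = subst (ChoiceAt u) (≡-sym (updateAt-minimal u j t u≢j)) (t-choice u)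

        partners-independent : ∀ {a b} → a ∈ₛ J → b ∈ₛ J → ¬ Edge C (p a) (p b)
        partners-independent {a} {b} a∈J b∈J pa-pb =
          no-induced-P4 C C-cograph (edge-sym C (t-edge a∈J)) pa-pb (t-edge b∈J)
            (λ ta-pb → a≢b (t-injective (only-neighbour b∈J (t-in a∈J) (edge-sym C ta-pb))))
            (K-stable _ _ (J⊆K _ (t-in a∈J)) (J⊆K _ (t-in b∈J)))
            (λ pa-tb → a≢b (t-injective (≡-sym (only-neighbour a∈J (t-in b∈J) pa-tb))))
          where
          a≢b : a ≢ b
          a≢b refl = edge-irrefl C pa-pb

        Same? : ∀ a b → Dec (Same col a b)
        Same? a b = _~_ col a b Bool.≟ true

        W : Subset C
        W u = does (any? (λ j → (j ∈? J) ×-dec Same? j u))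

        ∈W⁺ : ∀ {j u} → j ∈ₛ J → Same col j u → u ∈ W
        ∈W⁺ {j} {u} j∈J j~u = dec-true (any? (λ j → (j ∈? J) ×-dec Same? j u)) (j , j∈J , j~u)

        ∈W⁻ : ∀ u → u ∈ W → ∃[ j ] (j ∈ₛ J × Same col j u)
        ∈W⁻ u with any? (λ j → (j ∈? J) ×-dec Same? j u)
        ... | yes found = λ _ → found
        ... | no _ = λ ()

        W-cases : ∀ {u} → u ∈ W → ∃[ j ] (j ∈ₛ J × (u ≡ j ⊎ u ≡ p j))
        W-cases {u} u∈W with ∈W⁻ u u∈W
        ... | j , j∈J , j~u = j , j∈J , proj₂ (proj₂ (pair j∈J)) u j~u

        W-union : UnionOfTwoVertexClasses col W
        W-union = closed , two-vertex
          where
          closed : ∀ v w → v ∈ W → Same col v w → w ∈ W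
          closed v w v∈W v~w with ∈W⁻ v v∈W
          ... | j , j∈J , j~v = ∈W⁺ j∈J (~-trans col _ _ _ j~v v~w)
          two-vertex : ∀ v → v ∈ W → TwoVertexClass col v
          two-vertex v v∈W with W-cases v∈W
          ... | j , j∈J , inj₁ refl = p j , pair j∈J
          ... | j , j∈J , inj₂ refl = j , PairClass-sym {c = col} (pair j∈J)

        W-matching : InducesMatching C W
        W-matching = (j₀ , ∈W⁺ j₀∈J (~-refl col j₀)) , matched
          where
          j₀ = proj₁ J-nonempty
          j₀∈J = proj₂ J-nonempty
          matched : ∀ w → w ∈ W → ∃[ w′ ] ((w′ ∈ W × Edge C w w′) ×
                                           (∀ w″ → w″ ∈ W → Edge C w w″ → w″ ≡ w′))
          matched w w∈W with W-cases w∈W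
          ... | j , j∈J , inj₁ refl with t-preimage j∈J
          ...   | a , a∈J , refl =
            p a , (∈W⁺ a∈J (proj₁ (proj₂ (pair a∈J))) , edge-sym C (t-edge a∈J)) , unique
            where
            unique : ∀ w″ → w″ ∈ W → Edge C (t a) w″ → w″ ≡ p a
            unique w″ w″∈W ta-w″ with W-cases w″∈W
            ... | j″ , j″∈J , inj₁ refl = ⊥-elim (K-stable _ _ (J⊆K _ j∈J) (J⊆K _ j″∈J) ta-w″)
            ... | j″ , j″∈J , inj₂ refl =
              cong p (t-injective (≡-sym (only-neighbour j″∈J j∈J (edge-sym C ta-w″))))
          matched w w∈W | j , j∈J , inj₂ refl =
            t j , (∈W⁺ (t-in j∈J) (~-refl col (t j)) , t-edge j∈J) , unique
            where
            unique : ∀ w″ → w″ ∈ W → Edge C (p j) w″ → w″ ≡ t j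
            unique w″ w″∈W pj-w″ with W-cases w″∈W
            ... | j″ , j″∈J , inj₁ refl = only-neighbour j∈J j″∈J pj-w″
            ... | j″ , j″∈J , inj₂ refl = ⊥-elim (partners-independent j∈J j″∈J pj-w″)

        impossible : ⊥
        impossible = proj₂ nice W W-union W-matching

  ¬all-partners-outside : ⊥
  ¬all-partners-outside = impossible (⊂-minimal candidate? (_ , K-candidate))
    where
    impossible : ∃[ J ] (Candidate J × ∀ {J′} → Candidate J′ → ¬ J′ ⊂ J) → ⊥
    impossible (J , (J-nonempty , J⊆K , J-closed) , J-minimal) =
      Matching.impossible (proj₂ choice)
      where open Minimal J-nonempty J⊆K J-closed J-minimal

module _ (P : CombProp) (prf : CombinatorialProof P) where
  open CombinatorialProof prf

  partner : Fin (size C) → Fin (size C)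
  partner v with axiomatic v
  ... | inj₁ _ = v
  ... | inj₂ (w , _) = w

  class-in-clause : ∀ {S} v → h v ∈ S → h (partner v) ∈ S → ClauseTrue (graph P) (label P) S
  class-in-clause v hv∈S hpv∈S with axiomatic v
  ... | inj₁ (_ , labelled-one) = inj₁ (h v , hv∈S , labelled-one)
  ... | inj₂ (_ , _ , _ , _ , dual) = inj₂ (h v , _ , hv∈S , hpv∈S , dual)

  partner-outside : ∀ {S} → (∀ v → h v ∈ S → ¬ h (partner v) ∈ S) →
                    ∀ v → h v ∈ S → PairClass colouring v (partner v) × ¬ h (partner v) ∈ S
  partner-outside never-both v hv∈S with axiomatic v | never-both v hv∈S
  ... | inj₁ _ | hpv∉S = contradiction hv∈S hpv∉S
  ... | inj₂ (_ , v≢w , v~w , class , _) | hpv∉S = (v≢w , v~w , class) , hpv∉S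

theorem3 : (P : CombProp) → CombinatorialProof P → IsTrue P
theorem3 P prf S S-clause = case any? class-in-preimage? of λ where
    (yes (v , v∈K , pv∈K)) → class-in-clause P prf {S} v v∈K pv∈K
    (no none) → ⊥-elim (¬all-partners-outside {C} C-cograph {colouring} nice {K}
                  K-stable K-dominating (partner P prf)
                  (partner-outside P prf {S} λ v v∈K pv∈K → none (v , v∈K , pv∈K)))
  where
  open CombinatorialProof prf
  K : Subset C
  K = S ∘ h
  K-stable : IsStable C K
  K-stable = preimage-stable {C} {graph P} {h} {S} (proj₁ skew) (proj₁ S-clause)
  K-dominating : Dominating C K
  K-dominating = preimage-dominating {C} {graph P} {h} {S} C-cograph (isCograph P) skew
                   (proj₁ S-clause) (clause⇒dominating (graph P) S-clause)
  class-in-preimage? : Decidable (λ v → v ∈ K × partner P prf v ∈ K)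
  class-in-preimage? v = (K v Bool.≟ true) ×-dec (K (partner P prf v) Bool.≟ true)
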